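{- Let $\{G_i\}$ be a family of graphs with a common induced subgraph $J$ with embeddings $J_i$ such that $\{(G_i|J_i)\}$ is isometric, and let $H=\amalg\{(G_i|J_i)\}$. If for each $i$ the set $A_i\subseteq V(G_i)$ is a local metric set for $G_i$, then $\bigcup_i A_i$ is a local metric set for $H$.
   Context: All graphs are finite, simple and non-null. $J$ is a common induced subgraph of the $G_i$ via injective maps $\iota_i:V(J)\to V(G_i)$ with $\iota_i(u)\iota_i(v)\in E(G_i)$ iff $uv\in E(J)$; $J_i$ is the induced subgraph of $G_i$ on $\iota_i(V(J))$, and $a^i=\iota_i(a)$. $H=\amalg\{(G_i|J_i)\}$ is obtained from the disjoint union of the $G_i$ by identifying, for each $a\in V(J)$, all vertices $a^i$ into one vertex (adjacencies preserved); each $V(G_i)$ is regarded as a subset of $V(H)$. The family is isometric if $d_{G_i}(a^i,b^i)=d_{G_j}(a^j,b^j)$ for all $i,j$ and $a,b\in V(J)$. A vertex $w$ distinguishes an edge $uv$ of a graph $G$ if $d_G(w,u)\ne d_G(w,v)$; a local metric set of $G$ is a set of vertices distinguishing every edge of $G$. -}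

module Defs where

open import Data.Nat using (ℕ; zero; suc; _≤_; NonZero)
open import Data.Fin using (Fin)
open import Data.Maybe using (Maybe; just; nothing)
open import Data.Product using (Σ; ∃; _×_; _,_)
open import Data.Sum using (_⊎_)
open import Relation.Nullary using (¬_; Dec)
open import Relation.Binary.PropositionalEquality using (_≡_; _≢_)
open import Function.Bundles using (_⇔_)
open import Function.Definitions using (Injective)

data Walk {V : Set} (E : V → V → Set) : V → V → ℕ → Set where
  here : ∀ {u} → Walk E u u 0
  step : ∀ {u w v k} → E u w → Walk E w v k → Walk E u v (suc k)

-- HasDist E u v d : the distance from u to v is d,
-- where  nothing  stands for ∞ (no walk at all).
HasDist : {V : Set} → (V → V → Set) → V → V → Maybe ℕ → Set
HasDist E u v (just k) = Walk E u v k × (∀ m → Walk E u v m → k ≤ m)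
HasDist E u v nothing  = ∀ m → ¬ Walk E u v m

Distinguishes : {V : Set} → (V → V → Set) → V → V → V → Set
Distinguishes E w u v =
  ∀ a b → HasDist E w u a → HasDist E w v b → a ≢ b

IsLocalMetricSet : {V : Set} → (V → V → Set) → (V → Set) → Set
IsLocalMetricSet E A =
  ∀ u v → E u v → Σ _ λ w → A w × Distinguishes E w u v

record Graph : Set₁ where
  field
    n        : ℕ
    nonnull  : NonZero n
    E        : Fin n → Fin n → Set
    E-dec    : ∀ u v → Dec (E u v)
    E-sym    : ∀ {u v} → E u v → E v u
    E-irrefl : ∀ {u} → ¬ E u u
open Graph public

record CommonInduced (m : ℕ) (G : Fin m → Graph) : Set₁ where
  field
    J     : Graph
    ι     : (i : Fin m) → Fin (n J) → Fin (n (G i))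
    ι-inj : ∀ i → Injective _≡_ _≡_ (ι i)
    ι-ind : ∀ i a b → E (G i) (ι i a) (ι i b) ⇔ E J a b
open CommonInduced public

Isometric : ∀ {m G} → CommonInduced m G → Set
Isometric {m} {G} C = ∀ (i j : Fin m) (a b : Fin (n (J C))) (d : Maybe ℕ) →
  HasDist (E (G i)) (ι C i a) (ι C i b) d ⇔ HasDist (E (G j)) (ι C j a) (ι C j b) d

-- The amalgam H = ∐ (G_i | J_i): disjoint union of the G_i with all
-- copies a^i of each a ∈ V(J) identified into a single vertex.
-- Concretely, V(H) = V(J) ⊎ { (i , x) | x ∈ V(G_i) not in the image of ι i }.

module Amalgam {m : ℕ} {G : Fin m → Graph} (C : CommonInduced m G) where

  data HV : Set where
    shared : Fin (n (J C)) → HV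
    own    : (i : Fin m) (x : Fin (n (G i))) → .(∀ a → ι C i a ≢ x) → HV

  -- Emb i x h : the vertex x of G_i is the vertex h of H
  -- (this is how V(G_i) is regarded as a subset of V(H)).
  Emb : (i : Fin m) → Fin (n (G i)) → HV → Set
  Emb i x h =
    (Σ (Fin (n (J C))) λ a → ι C i a ≡ x × h ≡ shared a)
    ⊎ (Σ (∀ a → ι C i a ≢ x) λ p → h ≡ own i x p)

  HE : HV → HV → Set
  HE h h' = Σ (Fin m) λ i → Σ (Fin (n (G i))) λ x → Σ (Fin (n (G i))) λ y →
    Emb i x h × Emb i y h' × E (G i) x y

  ⋃ : ((i : Fin m) → Fin (n (G i)) → Set) → HV → Set
  ⋃ A h = Σ (Fin m) λ i → Σ (Fin (n (G i))) λ x → A i x × Emb i x h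

-- Each G_i sits isometrically in H. Walks of G_i lift to H. Conversely, an
-- H-walk between vertices of G_i can only leave G_i through a copy of J and
-- must re-enter through one; by isometry every such excursion through some
-- G_j can be replaced by a walk of G_i between the same two copies that is no
-- longer. So a vertex w ∈ A_i has the same distances to the ends of an edge
-- of G_i in H as in G_i, and distinguishes it in H as well.
module Submission where

open import Defs
open import Data.Nat using (ℕ; zero; suc; _+_; _≤_; _<_; z≤n; s≤s)
open import Data.Nat.Properties
  using (≤-refl; ≤-trans; ≤-antisym; +-mono-≤; ≮⇒≥; n<1+n; m<n⇒m<1+n; m<1+n⇒m<n∨m≡n)
open import Data.Fin using (Fin)
open import Data.Fin.Properties using (any?) renaming (_≟_ to _≟ᶠ_)
open import Data.Maybe using (just; nothing)
open import Data.Product using (Σ; _×_; _,_; proj₁)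
open import Data.Sum using (_⊎_; inj₁; inj₂)
open import Data.Empty using (⊥-elim)
open import Relation.Nullary using (¬_; Dec; yes; no)
open import Relation.Nullary.Decidable using (map′; _×-dec_)
open import Relation.Unary using (Decidable)
open import Relation.Binary.PropositionalEquality using (_≡_; _≢_; refl; sym; trans; cong)
open import Function.Bundles using (Equivalence)

-- HasDist E x y (just d) unfolds to Least (λ k → Walk E x y k) d.
Least : (ℕ → Set) → ℕ → Set
Least P d = P d × (∀ m → P m → d ≤ m)

module _ {P : ℕ → Set} (P? : Decidable P) where

  least-below : ∀ k → (∀ m → m < k → ¬ P m) ⊎ Σ ℕ (λ d → d < k × Least P d)
  least-below zero = inj₁ λ m ()
  least-below (suc k) with least-below k
  ... | inj₂ (d , d<k , d-least) = inj₂ (d , m<n⇒m<1+n d<k , d-least)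
  ... | inj₁ none with P? k
  ...   | yes pk = inj₂ (k , n<1+n k , pk , λ m pm → ≮⇒≥ λ m<k → none m m<k pm)
  ...   | no ¬pk = inj₁ none′
    where
    none′ : ∀ m → m < suc k → ¬ P m
    none′ m m<1+k with m<1+n⇒m<n∨m≡n m<1+k
    ... | inj₁ m<k  = none m m<k
    ... | inj₂ refl = ¬pk

  least : ∀ {k} → P k → Σ ℕ λ d → d ≤ k × Least P d
  least {k} pk with least-below (suc k)
  ... | inj₁ none                    = ⊥-elim (none k (n<1+n k) pk)
  ... | inj₂ (d , s≤s d≤k , d-least) = d , d≤k , d-least

module _ {V : Set} {E : V → V → Set} where

  infixr 5 _++ʷ_ _++≤_

  _++ʷ_ : ∀ {x y z k₁ k₂} → Walk E x y k₁ → Walk E y z k₂ → Walk E x z (k₁ + k₂)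
  here     ++ʷ w′ = w′
  step e w ++ʷ w′ = step e (w ++ʷ w′)

  Walk≤ : V → V → ℕ → Set
  Walk≤ x y k = Σ ℕ λ k′ → k′ ≤ k × Walk E x y k′

  walk⇒walk≤ : ∀ {x y k} → Walk E x y k → Walk≤ x y k
  walk⇒walk≤ w = _ , ≤-refl , w

  walk≤-weaken : ∀ {x y k k′} → k ≤ k′ → Walk≤ x y k → Walk≤ x y k′
  walk≤-weaken k≤k′ (l , l≤k , w) = l , ≤-trans l≤k k≤k′ , w

  walk≤-step : ∀ {x y z k} → E x y → Walk≤ y z k → Walk≤ x z (suc k)
  walk≤-step e (l , l≤k , w) = suc l , s≤s l≤k , step e w

  _++≤_ : ∀ {x y z k₁ k₂} → Walk≤ x y k₁ → Walk≤ y z k₂ → Walk≤ x z (k₁ + k₂)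
  (l₁ , l₁≤k₁ , w₁) ++≤ (l₂ , l₂≤k₂ , w₂) = l₁ + l₂ , +-mono-≤ l₁≤k₁ l₂≤k₂ , w₁ ++ʷ w₂

module _ (G : Graph) where

  walk? : ∀ k x y → Dec (Walk (E G) x y k)
  walk? zero x y = map′ (λ { refl → here }) (λ { here → refl }) (x ≟ᶠ y)
  walk? (suc k) x y =
    map′ (λ { (z , e , w) → step e w }) (λ { (step e w) → _ , e , w })
         (any? λ z → E-dec G x z ×-dec walk? k z y)

  walk⇒distance : ∀ {x y k} → Walk (E G) x y k →
    Σ ℕ λ d → d ≤ k × HasDist (E G) x y (just d)
  walk⇒distance {x} {y} = least (λ k → walk? k x y)

module _ {m : ℕ} {G : Fin m → Graph} (C : CommonInduced m G) where
  open Amalgam C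

  Emb-injective : ∀ {i x x′ h} → Emb i x h → Emb i x′ h → x ≡ x′
  Emb-injective (inj₁ (a , refl , refl)) (inj₁ (.a , refl , refl)) = refl
  Emb-injective (inj₁ (a , _ , refl))    (inj₂ (_ , ()))
  Emb-injective (inj₂ (_ , refl))        (inj₁ (_ , _ , ()))
  Emb-injective (inj₂ (_ , refl))        (inj₂ (_ , refl))        = refl

  Emb-functional : ∀ {i x h h′} → Emb i x h → Emb i x h′ → h ≡ h′
  Emb-functional {i} (inj₁ (a , ea , refl)) (inj₁ (b , eb , refl)) =
    cong shared (ι-inj C i (trans ea (sym eb)))
  Emb-functional (inj₁ (a , ea , refl)) (inj₂ (q , refl))      = ⊥-elim (q a ea)
  Emb-functional (inj₂ (p , refl))      (inj₁ (b , eb , refl)) = ⊥-elim (p b eb)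
  Emb-functional (inj₂ (p , refl))      (inj₂ (q , refl))      = refl

  Emb-portal : ∀ {i j x y h} → j ≢ i → Emb j x h → Emb i y h →
    Σ (Fin (n (J C))) λ a → x ≡ ι C j a × y ≡ ι C i a
  Emb-portal _   (inj₁ (a , refl , refl)) (inj₁ (.a , refl , refl)) = a , refl , refl
  Emb-portal _   (inj₁ (a , _ , refl))    (inj₂ (_ , ()))
  Emb-portal _   (inj₂ (_ , refl))        (inj₁ (_ , _ , ()))
  Emb-portal j≢i (inj₂ (_ , refl))        (inj₂ (_ , refl))        = ⊥-elim (j≢i refl)

  embed : ∀ i x → Σ HV (Emb i x)
  embed i x with any? (λ a → ι C i a ≟ᶠ x)
  ... | yes (a , ea) = shared a , inj₁ (a , ea , refl)
  ... | no ¬image    = own i x fresh , inj₂ (fresh , refl)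
    where
    fresh : ∀ a → ι C i a ≢ x
    fresh a ea = ¬image (a , ea)

  lift : ∀ {i x y k h h′} → Walk (E (G i)) x y k → Emb i x h → Emb i y h′ → Walk HE h h′ k
  lift here hx hy with refl ← Emb-functional hx hy = here
  lift {i} (step {w = z} e w) hx hy with _ , ez ← embed i z =
    step (i , _ , z , hx , ez , e) (lift w ez hy)

  module _ (iso : Isometric C) where

    transport : ∀ l i a b {k} → Walk (E (G l)) (ι C l a) (ι C l b) k →
      Walk≤ {E = E (G i)} (ι C i a) (ι C i b) k
    transport l i a b w with d , d≤k , dist ← walk⇒distance (G l) w =
      d , d≤k , Equivalence.to (iso l i a b (just d)) dist .proj₁

    module Projection (i : Fin m) {y : Fin (n (G i))} {h′ : HV} (hy : Emb i y h′) where

      ViaPortal : (j : Fin m) → Fin (n (G j)) → ℕ → Set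
      ViaPortal j x k = Σ (Fin (n (J C))) λ a → Σ ℕ λ k₁ → Σ ℕ λ k₂ →
        k₁ + k₂ ≤ k × Walk (E (G j)) x (ι C j a) k₁ × Walk (E (G i)) (ι C i a) y k₂

      -- Induction hypothesis for H-walks ending at h′; the outside clause is
      -- needed because the tail of such a walk may start inside another G_j.
      record Bound (h : HV) (k : ℕ) : Set where
        field
          inside  : ∀ {x} → Emb i x h → Walk≤ {E = E (G i)} x y k
          outside : ∀ {j x} → j ≢ i → Emb j x h → ViaPortal j x k
      open Bound

      bound-here : Bound h′ 0
      bound-here .inside hx with refl ← Emb-injective hx hy = walk⇒walk≤ here
      bound-here .outside j≢i hx with a , refl , refl ← Emb-portal j≢i hx hy =
        a , 0 , 0 , z≤n , here , here

      inside-step : ∀ {h h₁ k x} → HE h h₁ → Bound h₁ k → Emb i x h →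
        Walk≤ {E = E (G i)} x y (suc k)
      inside-step (l , x′ , y′ , hx′ , hy′ , e) B hx with l ≟ᶠ i
      ... | yes refl with refl ← Emb-injective hx′ hx = walk≤-step e (B .inside hy′)
      ... | no l≢i
        with a , refl , refl ← Emb-portal l≢i hx′ hx
           | b , k₁ , k₂ , k₁+k₂≤k , w₁ , w₂ ← B .outside l≢i hy′ =
        walk≤-weaken (s≤s k₁+k₂≤k) (transport l i a b (step e w₁) ++≤ walk⇒walk≤ w₂)

      outside-step : ∀ {h h₁ k j x} → HE h h₁ → Bound h₁ k → j ≢ i → Emb j x h →
        ViaPortal j x (suc k)
      outside-step edge B j≢i (inj₁ (a , refl , refl))
        with k₂ , k₂≤1+k , w ← inside-step edge B (inj₁ (a , refl , refl)) =
        a , 0 , k₂ , k₂≤1+k , here , w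
      outside-step (_ , _ , _ , inj₁ (_ , _ , ()) , _ , _) B j≢i (inj₂ (_ , refl))
      outside-step (_ , _ , y′ , inj₂ (_ , refl) , hy′ , e) B j≢i (inj₂ (_ , refl))
        with a , k₁ , k₂ , k₁+k₂≤k , w₁ , w₂ ← B .outside j≢i hy′ =
        a , suc k₁ , k₂ , s≤s k₁+k₂≤k , step e w₁ , w₂

      bound : ∀ {h k} → Walk HE h h′ k → Bound h k
      bound here = bound-here
      bound (step edge w) .inside  = inside-step edge (bound w)
      bound (step edge w) .outside = outside-step edge (bound w)

    project : ∀ {i x y k h h′} → Walk HE h h′ k → Emb i x h → Emb i y h′ →
      Walk≤ {E = E (G i)} x y k
    project {i} w hx hy = Projection.bound i hy w .Projection.Bound.inside hx

    HasDist-restrict : ∀ {i x y h h′} d → Emb i x h → Emb i y h′ →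
      HasDist HE h h′ d → HasDist (E (G i)) x y d
    HasDist-restrict (just k) hx hy (w , minimal)
      with k′ , k′≤k , w′ ← project w hx hy
      with refl ← ≤-antisym k′≤k (minimal k′ (lift w′ hx hy)) =
      w′ , λ l wₗ → minimal l (lift wₗ hx hy)
    HasDist-restrict nothing hx hy unreachable l w = unreachable l (lift w hx hy)

lemma4 : (m : ℕ) (G : Fin m → Graph) (C : CommonInduced m G) →
    Isometric C →
    (A : (i : Fin m) → Fin (n (G i)) → Set) →
    (∀ i → IsLocalMetricSet (E (G i)) (A i)) →
    IsLocalMetricSet (Amalgam.HE C) (Amalgam.⋃ C A)
lemma4 m G C iso A locally-metric u v (i , x , y , hx , hy , e)
  with w , w∈A , w-distinguishes ← locally-metric i x y e
  with hw , ew ← embed C i w =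
  hw , (i , w , w∈A , ew) , λ a b da db →
    w-distinguishes a b (HasDist-restrict C iso a ew hx da) (HasDist-restrict C iso b ew hy db)
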